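{- Suppose $f\in\mathrm{QSym}$ and $f=\sum_\alpha c_\alpha\psi_\alpha$. Then for every composition $\alpha$, $c_\alpha=\mathrm{MinOne}^{\otimes l(\alpha)}(\Delta_\alpha f)$.
   Context: $\mathrm{QSym}$ is the algebra of quasisymmetric functions over $\mathbb{C}$, with monomial basis $M_\alpha=\sum_{i_1<\dots<i_k}x_{i_1}^{\alpha_1}\cdots x_{i_k}^{\alpha_k}$ and fundamental basis $L_\alpha=\sum_{\beta\text{ refines }\alpha}M_\beta$. For a composition $\alpha=(\alpha_1,\dots,\alpha_l)$ (with $l(\alpha)=l$) let $\pi(\alpha)=\prod_{i=1}^{l}(\alpha_1+\cdots+\alpha_i)$; if $\alpha$ refines $\beta$, let $\alpha^{(i)}$ be the parts of $\alpha$ summing to $\beta_i$ and $\pi(\alpha,\beta)=\prod_i\pi(\alpha^{(i)})$. Define $\psi_\alpha=\sum_{\beta\text{ coarsens }\alpha}\frac{1}{\pi(\alpha,\beta)}M_\beta$ (these form a basis). $\mathrm{MinOne}$ is the linear functional on $\mathrm{QSym}$ with $\mathrm{MinOne}(L_\alpha)=(-1)^k$ if $\alpha=(1^k,n-k)$ for some $0\le k<n$ ($n=|\alpha|$) and $0$ otherwise. The coproduct on $\mathrm{QSym}$ is $\Delta(M_\alpha)=\sum_{\beta\cdot\gamma=\alpha}M_\beta\otimes M_\gamma$ (deconcatenation, empty compositions allowed, $M_\varnothing=1$). For a composition $\alpha$ of length $l$, $\Delta_\alpha\colon\mathrm{QSym}\to\mathrm{QSym}^{\otimes l}$ is the $(l-1)$-fold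 iterated coproduct followed by projection onto $\mathrm{QSym}_{\alpha_1}\otimes\cdots\otimes\mathrm{QSym}_{\alpha_l}$ (where $\mathrm{QSym}_d$ is the degree-$d$ component). -}

module Defs where

open import Level using (_⊔_)
open import Data.Nat using (ℕ; zero; suc; pred; _≡ᵇ_)
import Data.Nat as ℕ
open import Data.Bool using (Bool; true; false; _∧_; if_then_else_)
open import Data.List using (List; []; _∷_; _++_; map; concatMap; foldr; length)
open import Data.Nat.ListAction using (sum)
open import Data.List.Properties using (≡-dec)
open import Data.Product using (_×_; _,_)
open import Relation.Nullary.Decidable using (⌊_⌋)
open import Algebra.Bundles using (CommutativeRing)

-- A composition is encoded as a list of naturals where the entry k
-- stands for the (positive) part k+1.  This is a bijection between
-- List ℕ and the set of all compositions (including the empty one).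

Comp : Set
Comp = List ℕ

parts : Comp → List ℕ
parts = map suc

size : Comp → ℕ
size α = sum (parts α)

-- π(α) = ∏_i (α_1 + ... + α_i)
piAux : ℕ → List ℕ → ℕ
piAux acc []       = 1
piAux acc (p ∷ ps) = (acc ℕ.+ p) ℕ.* piAux (acc ℕ.+ p) ps

piC : Comp → ℕ
piC α = piAux 0 (parts α)

_≟C_ : (α β : Comp) → Bool
α ≟C β = ⌊ ≡-dec ℕ._≟_ α β ⌋

-- all compositions of n+1
comps1 : ℕ → List Comp
comps1 zero    = (0 ∷ []) ∷ []
comps1 (suc n) = map (0 ∷_) (comps1 n) ++ map incHead (comps1 n)
  where
  incHead : Comp → Comp
  incHead []      = []
  incHead (k ∷ γ) = suc k ∷ γ

refinements : Comp → List Comp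
refinements []      = [] ∷ []
refinements (a ∷ α) = concatMap (λ γ → map (γ ++_) (refinements α)) (comps1 a)

-- all ways of cutting α into consecutive nonempty blocks α^(1),...,α^(m);
-- these correspond bijectively to the coarsenings β of α (β_i = |α^(i)|)
blockings : Comp → List (List Comp)
blockings []      = [] ∷ []
blockings (a ∷ α) = concatMap ext (blockings α)
  where
  ext : List Comp → List (List Comp)
  ext []      = ((a ∷ []) ∷ []) ∷ []
  ext (b ∷ B) = ((a ∷ []) ∷ b ∷ B) ∷ ((a ∷ b) ∷ B) ∷ []

merge : List Comp → Comp
merge = map (λ b → pred (size b))

-- π(α,β) = ∏_i π(α^(i))
piBlocks : List Comp → ℕ
piBlocks = foldr (λ b r → piC b ℕ.* r) 1

-- all l-fold deconcatenations γ = γ^1 · ... · γ^l (empty pieces allowed);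
-- deconcat (suc l) realises the (l)-fold iterated coproduct (id ⊗ Δ^(l-1)) ∘ Δ
-- on M_γ, and deconcat 0 realises the counit.
splits : Comp → List (Comp × Comp)
splits []      = ([] , []) ∷ []
splits (a ∷ γ) = ([] , a ∷ γ) ∷ map (λ { (β , δ) → (a ∷ β , δ) }) (splits γ)

deconcat : ℕ → Comp → List (List Comp)
deconcat zero    []      = [] ∷ []
deconcat zero    (_ ∷ _) = []
deconcat (suc l) γ       =
  concatMap (λ { (β , δ) → map (β ∷_) (deconcat l δ) }) (splits γ)

-- does a tensor M_{γ^1} ⊗ ... ⊗ M_{γ^l} lie in QSym_{n_1} ⊗ ... ⊗ QSym_{n_l} ?
degreesMatch : List ℕ → List Comp → Bool
degreesMatch []       []       = true
degreesMatch (n ∷ ns) (γ ∷ γs) = (size γ ≡ᵇ n) ∧ degreesMatch ns γs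
degreesMatch _        _        = false

-- Quasisymmetric functions with coefficients in a commutative ring R,
-- where inv n is meant to be the inverse of n in R.

module QSym {c ℓ} (R : CommutativeRing c ℓ) (inv : ℕ → CommutativeRing.Carrier R) where
  open CommutativeRing R

  natR : ℕ → Carrier
  natR zero    = 0#
  natR (suc n) = 1# + natR n

  sumR : List Carrier → Carrier
  sumR = foldr _+_ 0#

  prodR : List Carrier → Carrier
  prodR = foldr _*_ 1#

  -- a finite formal linear combination Σ c_i B_{α_i} in some basis B
  Lin : Set c
  Lin = List (Carrier × Comp)

  coeff : Lin → Comp → Carrier
  coeff f β = sumR (map (λ { (a , γ) → if γ ≟C β then a else 0# }) f)

  -- ψ_α = Σ_{β coarsens α} (1/π(α,β)) M_β, in the M basis
  psiM : Comp → Lin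
  psiM α = map (λ B → (inv (piBlocks B) , merge B)) (blockings α)

  psiToM : Lin → Lin
  psiToM cs = concatMap (λ { (a , α) → map (λ { (q , β) → (a * q , β) }) (psiM α) }) cs

  -- value of MinOne on L_α
  minOneL : Comp → Carrier
  minOneL []            = 0#
  minOneL (_ ∷ [])      = 1#
  minOneL (zero ∷ b ∷ α)  = - minOneL (b ∷ α)
  minOneL (suc _ ∷ _ ∷ _) = 0#

  -- μ (the values of a linear functional on the M basis) is MinOne:
  -- its value on L_α = Σ_{β refines α} M_β equals minOneL α for every α.
  IsMinOne : (Comp → Carrier) → Set ℓ
  IsMinOne μ = ∀ α → sumR (map μ (refinements α)) ≈ minOneL α

  -- MinOne^{⊗ l(α)} (Δ_α f), for f given in the M basis, where MinOne is
  -- the linear functional with values μ on the M basis.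
  minOneΔ : (Comp → Carrier) → Comp → Lin → Carrier
  minOneΔ μ α f =
    sumR (map (λ { (a , β) →
      a * sumR (map (λ γs → if degreesMatch (parts α) γs then prodR (map μ γs) else 0#)
                    (deconcat (length α) β)) }) f)

-- Both sides are linear and a functional on formal combinations only sees their coefficients,
-- so it suffices that f ↦ MinOne^{⊗ l(α)}(Δ_α f) sends ψ_γ to δ_{αγ}. Since L is unitriangular
-- in M, MinOne is pinned down on the M basis by its values on L, which gives
-- MinOne(M_β) = (−1)^{l(β)−1} β_last. In the expansion of ψ_γ over the coarsenings of γ, the first
-- part of γ either is a block of its own or opens the first block, and 1/π(γ,β) factors
-- accordingly; against MinOne^{⊗} ∘ Δ_α the two contributions cancel unless the leading parts of γ
-- and α agree, so induction on γ leaves exactly δ_{αγ}.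

module Submission where

open import Defs
open import Algebra.Bundles using (CommutativeRing)
import Algebra.Properties.CommutativeSemigroup as CommutativeSemigroupProperties
open import Data.Bool using (Bool; true; false; _∧_; if_then_else_)
open import Data.List using (List; []; _∷_; _++_; map; concatMap; concat; length)
import Data.List.Properties as List
open import Data.List.Relation.Unary.All using (All; []; _∷_)
import Data.List.Relation.Unary.All as All
import Data.List.Relation.Unary.All.Properties as All
open import Data.Nat using (ℕ; zero; suc; pred; _≡ᵇ_; _≤_; _<_; z≤n; s≤s; NonZero)
import Data.Nat as ℕ
import Data.Nat.Properties as ℕ
open import Data.Nat.ListAction using (sum)
open import Data.Nat.ListAction.Properties using (sum-++)
open import Data.Empty using (⊥-elim)
open import Data.Product using (_×_; _,_; proj₁; proj₂)
open import Function using (_∘_)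
open import Level using (Level)
open import Relation.Binary.Definitions using (tri<; tri≈; tri>)
open import Relation.Binary.PropositionalEquality as ≡ using (_≡_; _≢_; refl; cong; cong₂)
open import Relation.Nullary using (Dec; yes; no)
open import Relation.Nullary.Decidable using (dec-true; dec-false; isYes≗does)

private
  variable
    ℓ₁ : Level
    I J : Set ℓ₁

incHead : Comp → Comp
incHead []      = []
incHead (k ∷ γ) = suc k ∷ γ

comps1-suc : ∀ n → comps1 (suc n) ≡ map (0 ∷_) (comps1 n) ++ map incHead (comps1 n)
comps1-suc n = cong (map (0 ∷_) (comps1 n) ++_)
  (List.map-cong (λ { [] → refl ; (k ∷ γ) → refl }) (comps1 n))

-- In the encoding sum γ = |γ| − l(γ): among compositions of one size, more parts
-- means a smaller sum, so refining can only lower it.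
infix 4 _≼_ _≺_
record _≼_ (β α : Comp) : Set where
  constructor _,_
  field
    size≡ : size β ≡ size α
    sum≤  : sum β ≤ sum α

record _≺_ (β α : Comp) : Set where
  constructor _,_
  field
    size≡ : size β ≡ size α
    sum<  : sum β < sum α

size-++ : ∀ γ β → size (γ ++ β) ≡ size γ ℕ.+ size β
size-++ γ β = ≡.trans (cong sum (List.map-++ suc γ β)) (sum-++ (parts γ) (parts β))

size-++-cong : ∀ γ γ′ β β′ → size γ ≡ size γ′ → size β ≡ size β′ →
               size (γ ++ β) ≡ size (γ′ ++ β′)
size-++-cong γ γ′ β β′ eγ eβ =
  ≡.trans (size-++ γ β) (≡.trans (cong₂ ℕ._+_ eγ eβ) (≡.sym (size-++ γ′ β′)))

sum-++-mono : ∀ (_R_ : ℕ → ℕ → Set) γ γ′ β β′ → (sum γ ℕ.+ sum β) R (sum γ′ ℕ.+ sum β′) →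
              sum (γ ++ β) R sum (γ′ ++ β′)
sum-++-mono _R_ γ γ′ β β′ = ≡.subst₂ _R_ (≡.sym (sum-++ γ β)) (≡.sym (sum-++ γ′ β′))

++-mono-≼ : ∀ {γ γ′ β β′} → γ ≼ γ′ → β ≼ β′ → γ ++ β ≼ γ′ ++ β′
++-mono-≼ {γ} {γ′} {β} {β′} (eγ , lγ) (eβ , lβ) =
  size-++-cong γ γ′ β β′ eγ eβ , sum-++-mono _≤_ γ γ′ β β′ (ℕ.+-mono-≤ lγ lβ)

++-mono-≺-≼ : ∀ {γ γ′ β β′} → γ ≺ γ′ → β ≼ β′ → γ ++ β ≺ γ′ ++ β′
++-mono-≺-≼ {γ} {γ′} {β} {β′} (eγ , lγ) (eβ , lβ) =
  size-++-cong γ γ′ β β′ eγ eβ , sum-++-mono _<_ γ γ′ β β′ (ℕ.+-mono-<-≤ lγ lβ)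

∷-mono-≺ : ∀ x {β α} → β ≺ α → x ∷ β ≺ x ∷ α
∷-mono-≺ x (e , l) = cong (suc x ℕ.+_) e , ℕ.+-monoʳ-< x l

comps1-≼ : ∀ n → All (_≼ n ∷ []) (comps1 n)
comps1-≼ zero    = (refl , ℕ.≤-refl) ∷ []
comps1-≼ (suc n) = ≡.subst (All (_≼ suc n ∷ [])) (≡.sym (comps1-suc n))
  (All.++⁺ (All.map⁺ (All.map cons0-≼ (comps1-≼ n))) (All.map⁺ (All.map incHead-≼ (comps1-≼ n))))
  where
  cons0-≼ : ∀ {γ} → γ ≼ n ∷ [] → 0 ∷ γ ≼ suc n ∷ []
  cons0-≼ (e , l) = cong suc e , ℕ.m≤n⇒m≤1+n l
  incHead-≼ : ∀ {γ} → γ ≼ n ∷ [] → incHead γ ≼ suc n ∷ []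
  incHead-≼ {[]}    (() , _)
  incHead-≼ {k ∷ γ} (e , l) = cong suc e , s≤s l

refinements-≼ : ∀ α → All (_≼ α) (refinements α)
refinements-≼ []      = (refl , z≤n) ∷ []
refinements-≼ (a ∷ α) = All.concat⁺ (All.map⁺ (All.map
  (λ γ≼a → All.map⁺ (All.map (++-mono-≼ γ≼a) (refinements-≼ α)))
  (comps1-≼ a)))

piBlocksFrom : ℕ → List Comp → ℕ
piBlocksFrom k []      = 1
piBlocksFrom k (b ∷ B) = piAux k (parts b) ℕ.* piBlocks B

mergeFrom : ℕ → List Comp → Comp
mergeFrom k []      = []
mergeFrom k (b ∷ B) = pred (k ℕ.+ size b) ∷ merge B

piBlocksFrom-0 : ∀ B → piBlocksFrom 0 B ≡ piBlocks B
piBlocksFrom-0 []      = refl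
piBlocksFrom-0 (b ∷ B) = refl

mergeFrom-0 : ∀ B → mergeFrom 0 B ≡ merge B
mergeFrom-0 []      = refl
mergeFrom-0 (b ∷ B) = refl

piAux-nonZero : ∀ acc γ → NonZero (piAux acc (parts γ))
piAux-nonZero acc []      = _
piAux-nonZero acc (x ∷ γ) = ℕ.m*n≢0 (acc ℕ.+ suc x) _
  {{ℕ.≢-nonZero (ℕ.m+1+n≢0 acc)}} {{piAux-nonZero (acc ℕ.+ suc x) γ}}

piBlocks-nonZero : ∀ B → NonZero (piBlocks B)
piBlocks-nonZero []      = _
piBlocks-nonZero (b ∷ B) = ℕ.m*n≢0 _ _ {{piAux-nonZero 0 b}} {{piBlocks-nonZero B}}

piBlocksFrom-nonZero : ∀ k B → NonZero (piBlocksFrom k B)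
piBlocksFrom-nonZero k []      = _
piBlocksFrom-nonZero k (b ∷ B) = ℕ.m*n≢0 _ _ {{piAux-nonZero k b}} {{piBlocks-nonZero B}}

piBlocksFrom-own : ∀ k c B → piBlocksFrom k ((c ∷ []) ∷ B) ≡ suc (k ℕ.+ c) ℕ.* piBlocksFrom 0 B
piBlocksFrom-own k c B =
  cong₂ ℕ._*_ (≡.trans (ℕ.*-identityʳ _) (ℕ.+-suc k c)) (≡.sym (piBlocksFrom-0 B))

mergeFrom-own : ∀ k c B → mergeFrom k ((c ∷ []) ∷ B) ≡ k ℕ.+ c ∷ mergeFrom 0 B
mergeFrom-own k c B = cong₂ _∷_
  (cong pred (≡.trans (cong (k ℕ.+_) (ℕ.+-identityʳ (suc c))) (ℕ.+-suc k c)))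
  (≡.sym (mergeFrom-0 B))

piBlocksFrom-joined : ∀ k c b B →
  piBlocksFrom k ((c ∷ b) ∷ B) ≡ suc (k ℕ.+ c) ℕ.* piBlocksFrom (suc (k ℕ.+ c)) (b ∷ B)
piBlocksFrom-joined k c b B = ≡.trans
  (cong (λ s → s ℕ.* piAux s (parts b) ℕ.* piBlocks B) (ℕ.+-suc k c))
  (ℕ.*-assoc (suc (k ℕ.+ c)) (piAux (suc (k ℕ.+ c)) (parts b)) (piBlocks B))

mergeFrom-joined : ∀ k c b B → mergeFrom k ((c ∷ b) ∷ B) ≡ mergeFrom (suc (k ℕ.+ c)) (b ∷ B)
mergeFrom-joined k c b B = cong (λ n → pred n ∷ merge B)
  (≡.trans (≡.sym (ℕ.+-assoc k (suc c) (size b))) (cong (ℕ._+ size b) (ℕ.+-suc k c)))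

extendBlocking : ℕ → List Comp → List (List Comp)
extendBlocking c []      = ((c ∷ []) ∷ []) ∷ []
extendBlocking c (b ∷ B) = ((c ∷ []) ∷ b ∷ B) ∷ ((c ∷ b) ∷ B) ∷ []

blockings-∷ : ∀ c γ → blockings (c ∷ γ) ≡ concatMap (extendBlocking c) (blockings γ)
blockings-∷ c γ = cong concat (List.map-cong (λ { [] → refl ; (b ∷ B) → refl }) (blockings γ))

data NonEmpty {a} {A : Set a} : List A → Set a where
  _∷_ : ∀ x xs → NonEmpty (x ∷ xs)

blockings-nonEmpty : ∀ c γ → All NonEmpty (blockings (c ∷ γ))
blockings-nonEmpty c γ = ≡.subst (All NonEmpty) (≡.sym (blockings-∷ c γ)) (extensions (blockings γ))
  where
  extensions : ∀ L → All NonEmpty (concatMap (extendBlocking c) L)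
  extensions []            = []
  extensions ([] ∷ L)      = (_ ∷ _) ∷ extensions L
  extensions ((b ∷ B) ∷ L) = (_ ∷ _) ∷ (_ ∷ _) ∷ extensions L

consFirst : ℕ → Comp × Comp → Comp × Comp
consFirst y p = y ∷ proj₁ p , proj₂ p

shiftHead : ℕ → Comp → Comp
shiftHead k []      = []
shiftHead k (c ∷ γ) = k ℕ.+ c ∷ γ

shiftHead-0 : ∀ γ → shiftHead 0 γ ≡ γ
shiftHead-0 []      = refl
shiftHead-0 (c ∷ γ) = refl

≡ᵇ-refl : ∀ m → (m ≡ᵇ m) ≡ true
≡ᵇ-refl m = dec-true (m ℕ.≟ m) refl

≢⇒≡ᵇ-false : ∀ {m n} → m ≢ n → (m ≡ᵇ n) ≡ false
≢⇒≡ᵇ-false {m} {n} = dec-false (m ℕ.≟ n)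

+-cancelˡ-≡ᵇ : ∀ k m n → (k ℕ.+ m ≡ᵇ k ℕ.+ n) ≡ (m ≡ᵇ n)
+-cancelˡ-≡ᵇ zero    m n = refl
+-cancelˡ-≡ᵇ (suc k) m n = +-cancelˡ-≡ᵇ k m n

≟C-true : ∀ {α β} → α ≡ β → (α ≟C β) ≡ true
≟C-true {α} {β} e =
  ≡.trans (isYes≗does (List.≡-dec ℕ._≟_ α β)) (dec-true (List.≡-dec ℕ._≟_ α β) e)

≟C-false : ∀ {α β} → α ≢ β → (α ≟C β) ≡ false
≟C-false {α} {β} ne =
  ≡.trans (isYes≗does (List.≡-dec ℕ._≟_ α β)) (dec-false (List.≡-dec ℕ._≟_ α β) ne)

≟C-∷-same : ∀ c γ α → ((c ∷ γ) ≟C (c ∷ α)) ≡ (γ ≟C α)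
≟C-∷-same c γ α = by-cases (List.≡-dec ℕ._≟_ γ α)
  where
  by-cases : Dec (γ ≡ α) → ((c ∷ γ) ≟C (c ∷ α)) ≡ (γ ≟C α)
  by-cases (yes refl) = ≡.trans (≟C-true refl) (≡.sym (≟C-true refl))
  by-cases (no γ≢α)   =
    ≡.trans (≟C-false (λ e → γ≢α (proj₂ (List.∷-injective e)))) (≡.sym (≟C-false γ≢α))

≟C-∷-≢ : ∀ {c a} γ α → c ≢ a → ((c ∷ γ) ≟C (a ∷ α)) ≡ false
≟C-∷-≢ γ α c≢a = ≟C-false (λ e → c≢a (proj₁ (List.∷-injective e)))

module Properties {c ℓ} (R : CommutativeRing c ℓ) (inv : ℕ → CommutativeRing.Carrier R) where
  open CommutativeRing R renaming (refl to ≈-refl; sym to ≈-sym; trans to ≈-trans)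
  open QSym R inv
  open import Algebra.Properties.Ring ring
    using (-‿distribˡ-*; -‿distribʳ-*; -0#≈0#; -‿+-comm; -1*x≈-x; x∙y⁻¹≈ε⇒x≈y)
  open import Algebra.Properties.Semiring.Mult semiring using (×1-homo-*) renaming (_×_ to _×′_)
  open CommutativeSemigroupProperties +-commutativeSemigroup
    using () renaming (interchange to +-interchange; x∙yz≈y∙xz to x+[y+z]≈y+[x+z])
  open CommutativeSemigroupProperties *-commutativeSemigroup
    using () renaming (interchange to *-interchange; x∙yz≈y∙xz to x*[y*z]≈y*[x*z])
  open import Relation.Binary.Reasoning.Setoid setoid

  ∑ : (I → Carrier) → List I → Carrier
  ∑ f xs = sumR (map f xs)

  ∑-++ : ∀ (f : I → Carrier) xs ys → ∑ f (xs ++ ys) ≈ ∑ f xs + ∑ f ys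
  ∑-++ f []       ys = ≈-sym (+-identityˡ _)
  ∑-++ f (x ∷ xs) ys = ≈-trans (+-congˡ (∑-++ f xs ys)) (≈-sym (+-assoc _ _ _))

  ∑-map : ∀ (f : J → Carrier) (g : I → J) xs → ∑ f (map g xs) ≈ ∑ (λ x → f (g x)) xs
  ∑-map f g xs = reflexive (cong sumR (≡.sym (List.map-∘ xs)))

  ∑-concatMap : ∀ (f : J → Carrier) (g : I → List J) xs →
                ∑ f (concatMap g xs) ≈ ∑ (λ x → ∑ f (g x)) xs
  ∑-concatMap f g []       = ≈-refl
  ∑-concatMap f g (x ∷ xs) = ≈-trans (∑-++ f (g x) (concatMap g xs)) (+-congˡ (∑-concatMap f g xs))

  ∑-congᴬ : ∀ {f g : I → Carrier} {xs} → All (λ x → f x ≈ g x) xs → ∑ f xs ≈ ∑ g xs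
  ∑-congᴬ []         = ≈-refl
  ∑-congᴬ (fx≈gx ∷ p) = +-cong fx≈gx (∑-congᴬ p)

  ∑-cong : ∀ {f g : I → Carrier} → (∀ x → f x ≈ g x) → ∀ xs → ∑ f xs ≈ ∑ g xs
  ∑-cong f≈g xs = ∑-congᴬ (All.universal f≈g xs)

  ∑-zero : ∀ (xs : List I) → ∑ (λ _ → 0#) xs ≈ 0#
  ∑-zero []       = ≈-refl
  ∑-zero (x ∷ xs) = ≈-trans (+-identityˡ _) (∑-zero xs)

  ∑-vanishᴬ : ∀ {f : I → Carrier} {xs} → All (λ x → f x ≈ 0#) xs → ∑ f xs ≈ 0#
  ∑-vanishᴬ {xs = xs} p = ≈-trans (∑-congᴬ p) (∑-zero xs)

  ∑-vanish : ∀ {f : I → Carrier} → (∀ x → f x ≈ 0#) → ∀ xs → ∑ f xs ≈ 0#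
  ∑-vanish f≈0 xs = ∑-vanishᴬ (All.universal f≈0 xs)

  ∑-+ : ∀ (f g : I → Carrier) xs → ∑ (λ x → f x + g x) xs ≈ ∑ f xs + ∑ g xs
  ∑-+ f g []       = ≈-sym (+-identityˡ 0#)
  ∑-+ f g (x ∷ xs) = ≈-trans (+-congˡ (∑-+ f g xs)) (+-interchange _ _ _ _)

  *-distribˡ-∑ : ∀ k (f : I → Carrier) xs → ∑ (λ x → k * f x) xs ≈ k * ∑ f xs
  *-distribˡ-∑ k f []       = ≈-sym (zeroʳ k)
  *-distribˡ-∑ k f (x ∷ xs) = ≈-trans (+-congˡ (*-distribˡ-∑ k f xs)) (≈-sym (distribˡ k _ _))

  -‿∑ : ∀ (f : I → Carrier) xs → ∑ (λ x → - f x) xs ≈ - ∑ f xs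
  -‿∑ f []       = ≈-sym -0#≈0#
  -‿∑ f (x ∷ xs) = ≈-trans (+-congˡ (-‿∑ f xs)) (-‿+-comm _ _)

  if-cong : ∀ b {x y} → x ≈ y → (if b then x else 0#) ≈ (if b then y else 0#)
  if-cong true  x≈y = x≈y
  if-cong false x≈y = ≈-refl

  if-vanish : ∀ b {x} → x ≈ 0# → (if b then x else 0#) ≈ 0#
  if-vanish true  x≈0 = x≈0
  if-vanish false x≈0 = ≈-refl

  if-true : ∀ {b} x → b ≡ true → (if b then x else 0#) ≈ x
  if-true x refl = ≈-refl

  if-false : ∀ {b} x → b ≡ false → (if b then x else 0#) ≈ 0#
  if-false x refl = ≈-refl

  *-if : ∀ b x y → x * (if b then y else 0#) ≈ (if b then x * y else 0#)
  *-if true  x y = ≈-refl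
  *-if false x y = zeroʳ x

  -‿if : ∀ b x → (if b then - x else 0#) ≈ - (if b then x else 0#)
  -‿if true  x = ≈-refl
  -‿if false x = ≈-sym -0#≈0#

  δ : Comp → Comp → Carrier
  δ α γ = if γ ≟C α then 1# else 0#

  δ-∷-same : ∀ c α γ → δ (c ∷ α) (c ∷ γ) ≈ δ α γ
  δ-∷-same c α γ = reflexive (cong (if_then 1# else 0#) (≟C-∷-same c γ α))

  δ-∷-≢ : ∀ {a c} α γ → c ≢ a → δ (a ∷ α) (c ∷ γ) ≈ 0#
  δ-∷-≢ α γ c≢a = reflexive (cong (if_then 1# else 0#) (≟C-∷-≢ γ α c≢a))

  δ-shiftHead-< : ∀ {a s} α γ → a < s → δ (a ∷ α) (shiftHead s γ) ≈ 0#
  δ-shiftHead-<         α []      a<s = ≈-refl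
  δ-shiftHead-< {s = s} α (d ∷ γ) a<s = δ-∷-≢ α γ (ℕ.>⇒≢ (ℕ.<-≤-trans a<s (ℕ.m≤m+n s d)))

  δ-shiftHead-+ : ∀ s q α γ → δ (s ℕ.+ q ∷ α) (shiftHead s γ) ≈ δ (q ∷ α) (shiftHead 0 γ)
  δ-shiftHead-+ s q α []      = ≈-refl
  δ-shiftHead-+ s q α (d ∷ γ) = by-cases (d ℕ.≟ q)
    where
    by-cases : Dec (d ≡ q) → δ (s ℕ.+ q ∷ α) (s ℕ.+ d ∷ γ) ≈ δ (q ∷ α) (d ∷ γ)
    by-cases (yes refl) = ≈-trans (δ-∷-same (s ℕ.+ d) α γ) (≈-sym (δ-∷-same d α γ))
    by-cases (no d≢q)   =
      ≈-trans (δ-∷-≢ α γ (λ e → d≢q (ℕ.+-cancelˡ-≡ s d q e))) (≈-sym (δ-∷-≢ α γ d≢q))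

  natR≡×′1# : ∀ n → natR n ≡ n ×′ 1#
  natR≡×′1# zero    = refl
  natR≡×′1# (suc n) = cong (1# +_) (natR≡×′1# n)

  natR-* : ∀ m n → natR (m ℕ.* n) ≈ natR m * natR n
  natR-* m n = begin
    natR (m ℕ.* n)          ≡⟨ natR≡×′1# (m ℕ.* n) ⟩
    (m ℕ.* n) ×′ 1#         ≈⟨ ×1-homo-* m n ⟩
    (m ×′ 1#) * (n ×′ 1#)   ≡⟨ cong₂ _*_ (natR≡×′1# m) (natR≡×′1# n) ⟨
    natR m * natR n         ∎

  *-inverse-unique : ∀ {x y z} → x * y ≈ 1# → x * z ≈ 1# → y ≈ z
  *-inverse-unique {x} {y} {z} xy≈1 xz≈1 = begin
    y             ≈⟨ *-identityʳ y ⟨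
    y * 1#        ≈⟨ *-congˡ xz≈1 ⟨
    y * (x * z)   ≈⟨ *-assoc y x z ⟨
    (y * x) * z   ≈⟨ *-congʳ (≈-trans (*-comm y x) xy≈1) ⟩
    1# * z        ≈⟨ *-identityˡ z ⟩
    z             ∎

  -- Linear functionals on formal combinations

  lin : (Comp → Carrier) → Lin → Carrier
  lin G = ∑ (λ p → proj₁ p * G (proj₂ p))

  lin-cong : ∀ {G H} → (∀ β → G β ≈ H β) → ∀ h → lin G h ≈ lin H h
  lin-cong G≈H = ∑-cong (λ p → *-congˡ (G≈H (proj₂ p)))

  lin-++ : ∀ G f h → lin G (f ++ h) ≈ lin G f + lin G h
  lin-++ G = ∑-++ _

  negateLin : Lin → Lin
  negateLin = map (λ p → - proj₁ p , proj₂ p)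

  lin-negate : ∀ G h → lin G (negateLin h) ≈ - lin G h
  lin-negate G h = begin
    lin G (negateLin h)                    ≈⟨ ∑-map _ _ h ⟩
    ∑ (λ p → - proj₁ p * G (proj₂ p)) h    ≈⟨ ∑-cong (λ p → -‿distribˡ-* _ _) h ⟨
    ∑ (λ p → - (proj₁ p * G (proj₂ p))) h  ≈⟨ -‿∑ _ h ⟩
    - lin G h                              ∎

  coeff≈lin-δ : ∀ h β → coeff h β ≈ lin (δ β) h
  coeff≈lin-δ h β = ∑-cong (λ p → coeff-term (proj₂ p ≟C β) (proj₁ p)) h
    where
    coeff-term : ∀ b x → (if b then x else 0#) ≈ x * (if b then 1# else 0#)
    coeff-term true  x = ≈-sym (*-identityʳ x)
    coeff-term false x = ≈-sym (zeroʳ x)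

  dropKey : Comp → Lin → Lin
  dropKey β []      = []
  dropKey β (p ∷ h) = if proj₂ p ≟C β then dropKey β h else p ∷ dropKey β h

  length-dropKey : ∀ β h → length (dropKey β h) ≤ length h
  length-dropKey β []      = z≤n
  length-dropKey β (p ∷ h) with proj₂ p ≟C β
  ... | true  = ℕ.m≤n⇒m≤1+n (length-dropKey β h)
  ... | false = s≤s (length-dropKey β h)

  lin-dropKey : ∀ G β h → lin G h ≈ coeff h β * G β + lin G (dropKey β h)
  lin-dropKey G β []            = ≈-sym (≈-trans (+-identityʳ _) (zeroˡ (G β)))
  lin-dropKey G β ((a , γ) ∷ h) with List.≡-dec ℕ._≟_ γ β
  ... | yes refl = begin
    a * G γ + lin G h                              ≈⟨ +-congˡ (lin-dropKey G γ h) ⟩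
    a * G γ + (coeff h γ * G γ + lin G (dropKey γ h)) ≈⟨ +-assoc _ _ _ ⟨
    (a * G γ + coeff h γ * G γ) + lin G (dropKey γ h) ≈⟨ +-congʳ (distribʳ (G γ) a (coeff h γ)) ⟨
    (a + coeff h γ) * G γ + lin G (dropKey γ h)       ∎
  ... | no _ = begin
    a * G γ + lin G h                              ≈⟨ +-congˡ (lin-dropKey G β h) ⟩
    a * G γ + (coeff h β * G β + lin G (dropKey β h)) ≈⟨ x+[y+z]≈y+[x+z] _ _ _ ⟩
    coeff h β * G β + (a * G γ + lin G (dropKey β h)) ≈⟨ +-congʳ (*-congʳ (+-identityˡ _)) ⟨
    (0# + coeff h β) * G β + (a * G γ + lin G (dropKey β h)) ∎

  dropKey-head : ∀ a γ h → dropKey γ ((a , γ) ∷ h) ≡ dropKey γ h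
  dropKey-head a γ h = cong (if_then dropKey γ h else (a , γ) ∷ dropKey γ h) (≟C-true refl)

  -- Deleting all terms on the basis element of the head keeps the other coefficients
  -- and shortens the combination.
  lin-vanish : ∀ G n h → length h ≤ n → (∀ β → coeff h β ≈ 0#) → lin G h ≈ 0#
  lin-vanish G n       []            _         _     = ≈-refl
  lin-vanish G (suc n) ((a , γ) ∷ h) (s≤s len) coeff≈0 = begin
    lin G h′                               ≈⟨ lin-dropKey G γ h′ ⟩
    coeff h′ γ * G γ + lin G (dropKey γ h′) ≈⟨ +-cong (head-vanishes (G γ)) rest≈0 ⟩
    0# + 0#                                ≈⟨ +-identityʳ 0# ⟩
    0#                                     ∎
    where
    h′ = (a , γ) ∷ h
    head-vanishes : ∀ x → coeff h′ γ * x ≈ 0#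
    head-vanishes x = ≈-trans (*-congʳ (coeff≈0 γ)) (zeroˡ x)
    remaining-coeff≈0 : ∀ β → coeff (dropKey γ h′) β ≈ 0#
    remaining-coeff≈0 β = begin
      coeff (dropKey γ h′) β                        ≈⟨ coeff≈lin-δ (dropKey γ h′) β ⟩
      lin (δ β) (dropKey γ h′)                      ≈⟨ +-identityˡ _ ⟨
      0# + lin (δ β) (dropKey γ h′)                 ≈⟨ +-congʳ (head-vanishes (δ β γ)) ⟨
      coeff h′ γ * δ β γ + lin (δ β) (dropKey γ h′) ≈⟨ lin-dropKey (δ β) γ h′ ⟨
      lin (δ β) h′                                  ≈⟨ coeff≈lin-δ h′ β ⟨
      coeff h′ β                                    ≈⟨ coeff≈0 β ⟩
      0#                                            ∎
    rest≈0 : lin G (dropKey γ h′) ≈ 0#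
    rest≈0 = ≈-trans (reflexive (cong (lin G) (dropKey-head a γ h)))
      (lin-vanish G n (dropKey γ h) (ℕ.≤-trans (length-dropKey γ h) len)
        (λ β → ≈-trans (reflexive (cong (λ h″ → coeff h″ β) (≡.sym (dropKey-head a γ h))))
                       (remaining-coeff≈0 β)))

  lin-coeff-ext : ∀ G f h → (∀ β → coeff f β ≈ coeff h β) → lin G f ≈ lin G h
  lin-coeff-ext G f h coeff≈ = x∙y⁻¹≈ε⇒x≈y _ _ (begin
    lin G f - lin G h                 ≈⟨ +-congˡ (lin-negate G h) ⟨
    lin G f + lin G (negateLin h)     ≈⟨ lin-++ G f (negateLin h) ⟨
    lin G (f ++ negateLin h)          ≈⟨ lin-vanish G _ (f ++ negateLin h) ℕ.≤-refl difference≈0 ⟩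
    0#                                ∎)
    where
    difference≈0 : ∀ β → coeff (f ++ negateLin h) β ≈ 0#
    difference≈0 β = begin
      coeff (f ++ negateLin h) β                   ≈⟨ coeff≈lin-δ (f ++ negateLin h) β ⟩
      lin (δ β) (f ++ negateLin h)                 ≈⟨ lin-++ (δ β) f (negateLin h) ⟩
      lin (δ β) f + lin (δ β) (negateLin h)
        ≈⟨ +-cong (coeff≈lin-δ f β) (≈-sym (lin-negate (δ β) h)) ⟨
      coeff f β - lin (δ β) h
        ≈⟨ +-cong (≈-sym (coeff≈ β)) (-‿cong (coeff≈lin-δ h β)) ⟨
      coeff h β - coeff h β                        ≈⟨ -‿inverseʳ _ ⟩
      0#                                           ∎

  -- MinOne on the monomial basis

  minOneM : Comp → Carrier
  minOneM []          = 0#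
  minOneM (x ∷ [])    = natR (suc x)
  minOneM (x ∷ y ∷ β) = - minOneM (y ∷ β)

  sign : Comp → Carrier
  sign []      = 1#
  sign (x ∷ γ) = - sign γ

  minOneM-++ : ∀ γ y β → minOneM (γ ++ y ∷ β) ≈ sign γ * minOneM (y ∷ β)
  minOneM-++ []          y β = ≈-sym (*-identityˡ _)
  minOneM-++ (x ∷ [])    y β = ≈-sym (-1*x≈-x _)
  minOneM-++ (x ∷ z ∷ γ) y β = ≈-trans (-‿cong (minOneM-++ (z ∷ γ) y β)) (-‿distribˡ-* _ _)

  ∑-comps1-suc : ∀ (Y : Comp → Carrier) n →
    ∑ Y (comps1 (suc n)) ≈ ∑ (λ γ → Y (0 ∷ γ)) (comps1 n) + ∑ (λ γ → Y (incHead γ)) (comps1 n)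
  ∑-comps1-suc Y n = begin
    ∑ Y (comps1 (suc n))                                   ≡⟨ cong (∑ Y) (comps1-suc n) ⟩
    ∑ Y (map (0 ∷_) (comps1 n) ++ map incHead (comps1 n))  ≈⟨ ∑-++ Y (map (0 ∷_) (comps1 n)) _ ⟩
    ∑ Y (map (0 ∷_) (comps1 n)) + ∑ Y (map incHead (comps1 n))
      ≈⟨ +-cong (∑-map Y _ (comps1 n)) (∑-map Y _ (comps1 n)) ⟩
    ∑ (λ γ → Y (0 ∷ γ)) (comps1 n) + ∑ (λ γ → Y (incHead γ)) (comps1 n) ∎

  -- γ ≺ n ∷ [] says that γ has at least two parts.
  ∑-comps1-≺ : ∀ n (Y : Comp → Carrier) → (∀ γ → γ ≺ n ∷ [] → Y γ ≈ 0#) →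
               ∑ Y (comps1 n) ≈ Y (n ∷ [])
  ∑-comps1-≺ zero    Y Y≈0 = +-identityʳ _
  ∑-comps1-≺ (suc n) Y Y≈0 = begin
    ∑ Y (comps1 (suc n))                                  ≈⟨ ∑-comps1-suc Y n ⟩
    ∑ (λ γ → Y (0 ∷ γ)) C + ∑ (λ γ → Y (incHead γ)) C
      ≈⟨ +-cong (∑-vanishᴬ (All.map cons0-vanishes (comps1-≼ n)))
                (∑-comps1-≺ n (λ γ → Y (incHead γ)) incHead-vanishes) ⟩
    0# + Y (suc n ∷ [])                                   ≈⟨ +-identityˡ _ ⟩
    Y (suc n ∷ [])                                        ∎
    where
    C = comps1 n
    cons0-vanishes : ∀ {γ} → γ ≼ n ∷ [] → Y (0 ∷ γ) ≈ 0#
    cons0-vanishes {γ} (e , l) = Y≈0 (0 ∷ γ) (cong suc e , s≤s l)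
    incHead-vanishes : ∀ γ → γ ≺ n ∷ [] → Y (incHead γ) ≈ 0#
    incHead-vanishes []      (() , _)
    incHead-vanishes (k ∷ γ) (e , l) = Y≈0 (suc k ∷ γ) (cong suc e , s≤s l)

  -- Triangularity of the L basis in terms of the M basis.
  ∑-refinements-≺ : ∀ α (D : Comp → Carrier) → (∀ β → β ≺ α → D β ≈ 0#) →
                    ∑ D (refinements α) ≈ D α
  ∑-refinements-≺ []      D D≈0 = +-identityʳ _
  ∑-refinements-≺ (a ∷ α) D D≈0 = begin
    ∑ D (refinements (a ∷ α))                       ≈⟨ ∑-concatMap D _ (comps1 a) ⟩
    ∑ (λ γ → ∑ D (map (γ ++_) (refinements α))) (comps1 a)
      ≈⟨ ∑-cong (λ γ → ∑-map D (γ ++_) (refinements α)) (comps1 a) ⟩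
    ∑ Y (comps1 a)                                   ≈⟨ ∑-comps1-≺ a Y Y≈0 ⟩
    ∑ (λ β → D (a ∷ β)) (refinements α)
      ≈⟨ ∑-refinements-≺ α (λ β → D (a ∷ β)) (λ β β≺α → D≈0 (a ∷ β) (∷-mono-≺ a β≺α)) ⟩
    D (a ∷ α)                                        ∎
    where
    Y : Comp → Carrier
    Y γ = ∑ (λ β → D (γ ++ β)) (refinements α)
    Y≈0 : ∀ γ → γ ≺ a ∷ [] → Y γ ≈ 0#
    Y≈0 γ γ≺a = ∑-vanishᴬ (All.map (λ β≼α → D≈0 _ (++-mono-≺-≼ γ≺a β≼α)) (refinements-≼ α))

  ∑-sign-comps1-suc : ∀ n → ∑ sign (comps1 (suc n)) ≈ 0#
  ∑-sign-comps1-suc n = begin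
    ∑ sign (comps1 (suc n))                              ≈⟨ ∑-comps1-suc sign n ⟩
    ∑ (λ γ → - sign γ) C + ∑ (λ γ → sign (incHead γ)) C
      ≈⟨ +-cong (-‿∑ sign C) (∑-cong sign-incHead C) ⟩
    - ∑ sign C + ∑ sign C                                ≈⟨ -‿inverseˡ _ ⟩
    0#                                                   ∎
    where
    C = comps1 n
    sign-incHead : ∀ γ → sign (incHead γ) ≈ sign γ
    sign-incHead []      = ≈-refl
    sign-incHead (k ∷ γ) = ≈-refl

  isOnePart : Comp → Carrier
  isOnePart (x ∷ []) = 1#
  isOnePart _        = 0#

  ∑-minOneM-comps1 : ∀ n → ∑ minOneM (comps1 n) ≈ 1#
  ∑-minOneM-comps1 zero    = ≈-trans (+-identityʳ _) (+-identityʳ 1#)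
  ∑-minOneM-comps1 (suc n) = begin
    ∑ minOneM (comps1 (suc n))                                ≈⟨ ∑-comps1-suc minOneM n ⟩
    ∑ (λ γ → minOneM (0 ∷ γ)) C + ∑ (λ γ → minOneM (incHead γ)) C
      ≈⟨ +-cong (∑-congᴬ (All.map minOneM-cons0 (comps1-≼ n))) (∑-cong minOneM-incHead C) ⟩
    ∑ (λ γ → - minOneM γ) C + ∑ (λ γ → minOneM γ + isOnePart γ) C
      ≈⟨ +-cong (-‿∑ minOneM C) (∑-+ minOneM isOnePart C) ⟩
    - ∑ minOneM C + (∑ minOneM C + ∑ isOnePart C)             ≈⟨ +-assoc _ _ _ ⟨
    (- ∑ minOneM C + ∑ minOneM C) + ∑ isOnePart C             ≈⟨ +-congʳ (-‿inverseˡ _) ⟩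
    0# + ∑ isOnePart C                                        ≈⟨ +-identityˡ _ ⟩
    ∑ isOnePart C                                             ≈⟨ ∑-comps1-≺ n isOnePart one-part-≺ ⟩
    1#                                                        ∎
    where
    C = comps1 n
    minOneM-cons0 : ∀ {γ} → γ ≼ n ∷ [] → minOneM (0 ∷ γ) ≈ - minOneM γ
    minOneM-cons0 {[]}    (() , _)
    minOneM-cons0 {y ∷ γ} _ = ≈-refl
    minOneM-incHead : ∀ γ → minOneM (incHead γ) ≈ minOneM γ + isOnePart γ
    minOneM-incHead []          = ≈-sym (+-identityʳ _)
    minOneM-incHead (k ∷ [])    = +-comm _ _
    minOneM-incHead (k ∷ y ∷ γ) = ≈-sym (+-identityʳ _)
    one-part-≺ : ∀ γ → γ ≺ n ∷ [] → isOnePart γ ≈ 0#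
    one-part-≺ []          (() , _)
    one-part-≺ (x ∷ [])    (e , l) = ⊥-elim (ℕ.<-irrefl (ℕ.suc-injective e) l)
    one-part-≺ (x ∷ y ∷ γ) _       = ≈-refl

  isMinOne-minOneM : IsMinOne minOneM
  isMinOne-minOneM []          = +-identityʳ 0#
  isMinOne-minOneM (a ∷ [])    = begin
    ∑ minOneM (refinements (a ∷ []))          ≈⟨ ∑-concatMap minOneM _ (comps1 a) ⟩
    ∑ (λ γ → minOneM (γ ++ []) + 0#) (comps1 a)
      ≈⟨ ∑-cong (λ γ → ≈-trans (+-identityʳ _) (reflexive (cong minOneM (List.++-identityʳ γ))))
                (comps1 a) ⟩
    ∑ minOneM (comps1 a)                      ≈⟨ ∑-minOneM-comps1 a ⟩
    1#                                        ∎
  isMinOne-minOneM (a ∷ b ∷ α) = begin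
    ∑ minOneM (refinements (a ∷ b ∷ α))                  ≈⟨ ∑-concatMap minOneM _ (comps1 a) ⟩
    ∑ (λ γ → ∑ minOneM (map (γ ++_) Rb)) (comps1 a)
      ≈⟨ ∑-cong (first-block (isMinOne-minOneM (b ∷ α))) (comps1 a) ⟩
    ∑ (λ γ → m * sign γ) (comps1 a)                       ≈⟨ *-distribˡ-∑ m sign (comps1 a) ⟩
    m * ∑ sign (comps1 a)                                 ≈⟨ signed-total a ⟩
    minOneL (a ∷ b ∷ α)                                   ∎
    where
    Rb = refinements (b ∷ α)
    m  = minOneL (b ∷ α)
    minOneM-prefix : ∀ γ {β} → β ≼ b ∷ α → minOneM (γ ++ β) ≈ sign γ * minOneM β
    minOneM-prefix γ {[]}    (() , _)
    minOneM-prefix γ {y ∷ β} _ = minOneM-++ γ y β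
    first-block : ∑ minOneM Rb ≈ m → ∀ γ → ∑ minOneM (map (γ ++_) Rb) ≈ m * sign γ
    first-block ih γ = begin
      ∑ minOneM (map (γ ++_) Rb)        ≈⟨ ∑-map minOneM (γ ++_) Rb ⟩
      ∑ (λ β → minOneM (γ ++ β)) Rb
        ≈⟨ ∑-congᴬ (All.map (minOneM-prefix γ) (refinements-≼ (b ∷ α))) ⟩
      ∑ (λ β → sign γ * minOneM β) Rb   ≈⟨ *-distribˡ-∑ (sign γ) minOneM Rb ⟩
      sign γ * ∑ minOneM Rb             ≈⟨ *-congˡ ih ⟩
      sign γ * m                        ≈⟨ *-comm _ _ ⟩
      m * sign γ                        ∎
    signed-total : ∀ a → m * ∑ sign (comps1 a) ≈ minOneL (a ∷ b ∷ α)
    signed-total zero    =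
      ≈-trans (*-congˡ (+-identityʳ (- 1#))) (≈-trans (*-comm m (- 1#)) (-1*x≈-x m))
    signed-total (suc a) = ≈-trans (*-congˡ (∑-sign-comps1-suc a)) (zeroʳ m)

  isMinOne-unique : ∀ μ → IsMinOne μ → ∀ β → μ β ≈ minOneM β
  isMinOne-unique μ isMinOne β = below (suc (sum β)) β ℕ.≤-refl
    where
    below : ∀ n β → sum β < n → μ β ≈ minOneM β
    below (suc n) β (s≤s β≤n) = x∙y⁻¹≈ε⇒x≈y _ _ (begin
      μ β - minOneM β                       ≈⟨ ∑-refinements-≺ β D D≈0 ⟨
      ∑ D (refinements β)                   ≈⟨ ∑-+ μ (λ γ → - minOneM γ) (refinements β) ⟩
      ∑ μ (refinements β) + ∑ (λ γ → - minOneM γ) (refinements β)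
        ≈⟨ +-cong (isMinOne β)
                  (≈-trans (-‿∑ minOneM (refinements β)) (-‿cong (isMinOne-minOneM β))) ⟩
      minOneL β - minOneL β                 ≈⟨ -‿inverseʳ _ ⟩
      0#                                    ∎)
      where
      D : Comp → Carrier
      D γ = μ γ - minOneM γ
      D≈0 : ∀ γ → γ ≺ β → D γ ≈ 0#
      D≈0 γ (_ , γ<β) = ≈-trans (+-congʳ (below n γ (ℕ.<-≤-trans γ<β β≤n))) (-‿inverseʳ _)

  -- MinOne^{⊗ l(α)} ∘ Δ_α on the monomial basis

  minOneΔM : Comp → Comp → Carrier
  minOneΔM []      []      = 1#
  minOneΔM []      (_ ∷ _) = 0#
  minOneΔM (a ∷ α) β       =
    ∑ (λ p → if size (proj₁ p) ≡ᵇ suc a then minOneM (proj₁ p) * minOneΔM α (proj₂ p) else 0#)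
      (splits β)

  minOneΔM-[] : ∀ a α → minOneΔM (a ∷ α) [] ≈ 0#
  minOneΔM-[] a α = +-identityʳ 0#

  -- Splitting off the first part x of β: either it forms the whole first piece, or the
  -- first piece is longer and MinOne only sees its sign change.
  minOneΔM-∷ : ∀ a α x β → minOneΔM (a ∷ α) (x ∷ β) ≈
    (if x ≡ᵇ a then natR (suc x) * minOneΔM α β else 0#) -
    ∑ (λ p → if x ℕ.+ size (proj₁ p) ≡ᵇ a then minOneM (proj₁ p) * minOneΔM α (proj₂ p) else 0#)
      (splits β)
  minOneΔM-∷ a α x β = begin
    0# + ∑ F (map (consFirst x) (splits β))   ≈⟨ +-identityˡ _ ⟩
    ∑ F (map (consFirst x) (splits β))        ≈⟨ ∑-map F _ (splits β) ⟩
    ∑ (F ∘ consFirst x) (splits β)            ≈⟨ split-first β ⟩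
    whole β - ∑ G (splits β)                  ∎
    where
    F G : Comp × Comp → Carrier
    F p = if size (proj₁ p) ≡ᵇ suc a then minOneM (proj₁ p) * minOneΔM α (proj₂ p) else 0#
    G p = if x ℕ.+ size (proj₁ p) ≡ᵇ a then minOneM (proj₁ p) * minOneΔM α (proj₂ p) else 0#
    whole : Comp → Carrier
    whole β = if x ≡ᵇ a then natR (suc x) * minOneΔM α β else 0#
    whole-piece : ∀ β → F (x ∷ [] , β) ≈ whole β
    whole-piece β = reflexive (cong (λ n → if n ≡ᵇ a then natR (suc x) * minOneΔM α β else 0#)
                                    (ℕ.+-identityʳ x))
    empty-piece : ∀ β → G ([] , β) ≈ 0#
    empty-piece β = if-vanish (x ℕ.+ 0 ≡ᵇ a) (zeroˡ _)
    longer-pieces : ∀ y L → ∑ (F ∘ consFirst x) (map (consFirst y) L) ≈ - ∑ G (map (consFirst y) L)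
    longer-pieces y L = begin
      ∑ (F ∘ consFirst x) (map (consFirst y) L)        ≈⟨ ∑-map _ _ L ⟩
      ∑ (F ∘ consFirst x ∘ consFirst y) L
        ≈⟨ ∑-cong (λ p → ≈-trans (if-cong _ (≈-sym (-‿distribˡ-* _ _))) (-‿if _ _)) L ⟩
      ∑ (λ p → - G (consFirst y p)) L                  ≈⟨ -‿∑ _ L ⟩
      - ∑ (G ∘ consFirst y) L                          ≈⟨ -‿cong (∑-map G _ L) ⟨
      - ∑ G (map (consFirst y) L)                      ∎
    combine : ∀ {h w z t t′} → h ≈ w → z ≈ 0# → t ≈ - t′ → h + t ≈ w - (z + t′)
    combine h≈w z≈0 t≈-t′ =
      +-cong h≈w (≈-trans t≈-t′ (-‿cong (≈-trans (≈-sym (+-identityˡ _)) (+-congʳ (≈-sym z≈0)))))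
    split-first : ∀ β → ∑ (F ∘ consFirst x) (splits β) ≈ whole β - ∑ G (splits β)
    split-first []      = combine (whole-piece []) (empty-piece []) (≈-sym -0#≈0#)
    split-first (y ∷ β) =
      combine (whole-piece (y ∷ β)) (empty-piece (y ∷ β)) (longer-pieces y (splits β))

  minOneΔM-head : ∀ x α β → minOneΔM (x ∷ α) (x ∷ β) ≈ natR (suc x) * minOneΔM α β
  minOneΔM-head x α β = begin
    minOneΔM (x ∷ α) (x ∷ β)                             ≈⟨ minOneΔM-∷ x α x β ⟩
    (if x ≡ᵇ x then natR (suc x) * minOneΔM α β else 0#) - ∑ _ (splits β)
      ≈⟨ +-cong (if-true _ (≡ᵇ-refl x)) (-‿cong (∑-vanish longer-vanishes (splits β))) ⟩
    natR (suc x) * minOneΔM α β - 0#                     ≈⟨ +-congˡ -0#≈0# ⟩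
    natR (suc x) * minOneΔM α β + 0#                     ≈⟨ +-identityʳ _ ⟩
    natR (suc x) * minOneΔM α β                          ∎
    where
    longer-vanishes : ∀ p → (if x ℕ.+ size (proj₁ p) ≡ᵇ x
                             then minOneM (proj₁ p) * minOneΔM α (proj₂ p) else 0#) ≈ 0#
    longer-vanishes ([]     , _) = if-vanish (x ℕ.+ 0 ≡ᵇ x) (zeroˡ _)
    longer-vanishes (y ∷ β₁ , _) = if-false _ (≢⇒≡ᵇ-false (ℕ.m+1+n≢m x))

  minOneΔM-far : ∀ x q α β → minOneΔM (suc (x ℕ.+ q) ∷ α) (x ∷ β) ≈ - minOneΔM (q ∷ α) β
  minOneΔM-far x q α β = begin
    minOneΔM (suc (x ℕ.+ q) ∷ α) (x ∷ β)                 ≈⟨ minOneΔM-∷ (suc (x ℕ.+ q)) α x β ⟩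
    (if x ≡ᵇ suc (x ℕ.+ q) then _ else 0#) - ∑ _ (splits β)
      ≈⟨ +-cong (if-false _ (≢⇒≡ᵇ-false (ℕ.m≢1+m+n x))) (-‿cong (∑-cong shifted (splits β))) ⟩
    0# - minOneΔM (q ∷ α) β                              ≈⟨ +-identityˡ _ ⟩
    - minOneΔM (q ∷ α) β                                 ∎
    where
    shifted : ∀ p → (if x ℕ.+ size (proj₁ p) ≡ᵇ suc (x ℕ.+ q)
                     then minOneM (proj₁ p) * minOneΔM α (proj₂ p) else 0#) ≈
                    (if size (proj₁ p) ≡ᵇ suc q
                     then minOneM (proj₁ p) * minOneΔM α (proj₂ p) else 0#)
    shifted p = reflexive (cong (if_then minOneM (proj₁ p) * minOneΔM α (proj₂ p) else 0#)
      (≡.trans (cong (x ℕ.+ size (proj₁ p) ≡ᵇ_) (≡.sym (ℕ.+-suc x q))) (+-cancelˡ-≡ᵇ x _ (suc q))))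

  minOneΔM-near : ∀ a x α β → a < x → minOneΔM (a ∷ α) (x ∷ β) ≈ 0#
  minOneΔM-near a x α β a<x = begin
    minOneΔM (a ∷ α) (x ∷ β)                             ≈⟨ minOneΔM-∷ a α x β ⟩
    (if x ≡ᵇ a then _ else 0#) - ∑ _ (splits β)
      ≈⟨ +-cong (if-false _ (≢⇒≡ᵇ-false (ℕ.>⇒≢ a<x))) (-‿cong (∑-vanish too-long (splits β))) ⟩
    0# - 0#                                              ≈⟨ -‿inverseʳ 0# ⟩
    0#                                                   ∎
    where
    too-long : ∀ p → (if x ℕ.+ size (proj₁ p) ≡ᵇ a
                      then minOneM (proj₁ p) * minOneΔM α (proj₂ p) else 0#) ≈ 0#
    too-long p = if-false _ (≢⇒≡ᵇ-false (ℕ.>⇒≢ (ℕ.<-≤-trans a<x (ℕ.m≤m+n x (size (proj₁ p))))))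

  -- minOneΔ μ α is, by definition, lin (minOneΔ-onM μ α).
  minOneΔ-onPieces : (Comp → Carrier) → Comp → List Comp → Carrier
  minOneΔ-onPieces μ α γs = if degreesMatch (parts α) γs then prodR (map μ γs) else 0#

  minOneΔ-onM : (Comp → Carrier) → Comp → Comp → Carrier
  minOneΔ-onM μ α β = ∑ (minOneΔ-onPieces μ α) (deconcat (length α) β)

  minOneΔ-onM-minOneM : ∀ μ → (∀ β → μ β ≈ minOneM β) → ∀ α β → minOneΔ-onM μ α β ≈ minOneΔM α β
  minOneΔ-onM-minOneM μ μ≈ []      []      = +-identityʳ 1#
  minOneΔ-onM-minOneM μ μ≈ []      (x ∷ β) = ≈-refl
  minOneΔ-onM-minOneM μ μ≈ (a ∷ α) β       = begin
    minOneΔ-onM μ (a ∷ α) β                              ≈⟨ ∑-concatMap F _ (splits β) ⟩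
    ∑ (λ p → ∑ F (map (proj₁ p ∷_) (pieces p))) (splits β)
      ≈⟨ ∑-cong (λ p → ∑-map F (proj₁ p ∷_) (pieces p)) (splits β) ⟩
    ∑ (λ p → ∑ (λ γs → F (proj₁ p ∷ γs)) (pieces p)) (splits β)
      ≈⟨ ∑-cong (λ p → factor-first-piece (first-fits p) (μ (proj₁ p)) (pieces p)) (splits β) ⟩
    ∑ (λ p → if first-fits p then μ (proj₁ p) * minOneΔ-onM μ α (proj₂ p) else 0#) (splits β)
      ≈⟨ ∑-cong (λ p → if-cong (first-fits p)
                         (*-cong (μ≈ (proj₁ p)) (minOneΔ-onM-minOneM μ μ≈ α (proj₂ p)))) (splits β) ⟩
    minOneΔM (a ∷ α) β                                   ∎
    where
    F = minOneΔ-onPieces μ (a ∷ α)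
    first-fits : Comp × Comp → Bool
    first-fits p = size (proj₁ p) ≡ᵇ suc a
    pieces : Comp × Comp → List (List Comp)
    pieces p = deconcat (length α) (proj₂ p)
    factor-first-piece : ∀ b u L →
      ∑ (λ γs → if b ∧ degreesMatch (parts α) γs then u * prodR (map μ γs) else 0#) L ≈
      (if b then u * ∑ (minOneΔ-onPieces μ α) L else 0#)
    factor-first-piece true  u L =
      ≈-trans (∑-cong (λ γs → ≈-sym (*-if _ u _)) L) (*-distribˡ-∑ u _ L)
    factor-first-piece false u L = ∑-zero L

  -- Coarsening sums

  coarseningTerm : ℕ → (Comp → Carrier) → List Comp → Carrier
  coarseningTerm k F B = inv (piBlocksFrom k B) * F (mergeFrom k B)

  -- ∑ over the coarsenings β of γ of F(β)/π(γ,β), except that the partial sums of the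
  -- first block start at k and its part is enlarged by k; lin F (psiM γ) is the case k = 0.
  coarseningSum : ℕ → (Comp → Carrier) → Comp → Carrier
  coarseningSum k F γ = ∑ (coarseningTerm k F) (blockings γ)

  lin-psiM : ∀ G γ → lin G (psiM γ) ≈ coarseningSum 0 G γ
  lin-psiM G γ = ≈-trans (∑-map _ _ (blockings γ)) (∑-cong (λ B → reflexive
    (≡.sym (cong₂ (λ P M → inv P * G M) (piBlocksFrom-0 B) (mergeFrom-0 B)))) (blockings γ))

  lin-psiToM : ∀ G cs → lin G (psiToM cs) ≈ ∑ (λ p → proj₁ p * lin G (psiM (proj₂ p))) cs
  lin-psiToM G cs = ≈-trans (∑-concatMap _ _ cs) (∑-cong (λ { (a , γ) → begin
    ∑ _ (map _ (psiM γ))                                 ≈⟨ ∑-map _ _ (psiM γ) ⟩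
    ∑ (λ q → (a * proj₁ q) * G (proj₂ q)) (psiM γ)       ≈⟨ ∑-cong (λ q → *-assoc _ _ _) (psiM γ) ⟩
    ∑ (λ q → a * (proj₁ q * G (proj₂ q))) (psiM γ)       ≈⟨ *-distribˡ-∑ a _ (psiM γ) ⟩
    a * lin G (psiM γ)                                   ∎ }) cs)

  coarseningSum-cong : ∀ k {F G} → (∀ β → F β ≈ G β) → ∀ γ →
                       coarseningSum k F γ ≈ coarseningSum k G γ
  coarseningSum-cong k F≈G γ = ∑-cong (λ B → *-congˡ (F≈G _)) (blockings γ)

  coarseningSum-vanish : ∀ k {F} → (∀ β → F β ≈ 0#) → ∀ γ → coarseningSum k F γ ≈ 0#
  coarseningSum-vanish k F≈0 γ = ∑-vanish (λ B → ≈-trans (*-congˡ (F≈0 _)) (zeroʳ _)) (blockings γ)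

  coarseningSum-scale : ∀ k s F γ → coarseningSum k (λ β → s * F β) γ ≈ s * coarseningSum k F γ
  coarseningSum-scale k s F γ =
    ≈-trans (∑-cong (λ B → x*[y*z]≈y*[x*z] _ s _) (blockings γ)) (*-distribˡ-∑ s _ (blockings γ))

  coarseningSum-neg : ∀ k F γ → coarseningSum k (λ β → - F β) γ ≈ - coarseningSum k F γ
  coarseningSum-neg k F γ =
    ≈-trans (∑-cong (λ B → ≈-sym (-‿distribʳ-* _ _)) (blockings γ)) (-‿∑ _ (blockings γ))

  module Inverses (natR*inv≈1 : ∀ n → natR (suc n) * inv (suc n) ≈ 1#) where

    inv-1 : inv 1 ≈ 1#
    inv-1 = *-inverse-unique (natR*inv≈1 0) (≈-trans (*-identityʳ _) (+-identityʳ 1#))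

    inv-* : ∀ m n → .{{NonZero n}} → inv (suc m ℕ.* n) ≈ inv (suc m) * inv n
    inv-* m (suc n) = *-inverse-unique (natR*inv≈1 (n ℕ.+ m ℕ.* suc n)) (begin
      natR (suc m ℕ.* suc n) * (inv (suc m) * inv (suc n))
        ≈⟨ *-congʳ (natR-* (suc m) (suc n)) ⟩
      (natR (suc m) * natR (suc n)) * (inv (suc m) * inv (suc n))
        ≈⟨ *-interchange _ _ _ _ ⟩
      (natR (suc m) * inv (suc m)) * (natR (suc n) * inv (suc n))
        ≈⟨ *-cong (natR*inv≈1 m) (natR*inv≈1 n) ⟩
      1# * 1#
        ≈⟨ *-identityʳ 1# ⟩
      1# ∎)

    weight-split : ∀ m P .{{_ : NonZero P}} (F : Comp → Carrier) {N M M′} →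
                   N ≡ suc m ℕ.* P → M ≡ M′ → inv N * F M ≈ inv (suc m) * (inv P * F M′)
    weight-split m P F refl refl = ≈-trans (*-congʳ (inv-* m P)) (*-assoc _ _ _)

    coarseningTerm-own : ∀ k F c B → coarseningTerm k F ((c ∷ []) ∷ B) ≈
                         inv (suc (k ℕ.+ c)) * coarseningTerm 0 (λ β → F (k ℕ.+ c ∷ β)) B
    coarseningTerm-own k F c B =
      weight-split (k ℕ.+ c) (piBlocksFrom 0 B) {{piBlocksFrom-nonZero 0 B}} F
                   (piBlocksFrom-own k c B) (mergeFrom-own k c B)

    coarseningTerm-joined : ∀ k F c b B → coarseningTerm k F ((c ∷ b) ∷ B) ≈
                            inv (suc (k ℕ.+ c)) * coarseningTerm (suc (k ℕ.+ c)) F (b ∷ B)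
    coarseningTerm-joined k F c b B =
      weight-split (k ℕ.+ c) (piBlocksFrom (suc (k ℕ.+ c)) (b ∷ B))
                   {{piBlocksFrom-nonZero (suc (k ℕ.+ c)) (b ∷ B)}} F
                   (piBlocksFrom-joined k c b B) (mergeFrom-joined k c b B)

    -- The first part c of γ either is a block of its own or opens the first block.
    coarseningSum-∷ : ∀ k F c γ → F [] ≈ 0# →
      coarseningSum k F (c ∷ γ) ≈
      inv (suc (k ℕ.+ c)) *
        (coarseningSum 0 (λ β → F (k ℕ.+ c ∷ β)) γ + coarseningSum (suc (k ℕ.+ c)) F γ)
    coarseningSum-∷ k F c [] F[]≈0 = begin
      coarseningTerm k F ((c ∷ []) ∷ []) + 0#         ≈⟨ +-identityʳ _ ⟩
      coarseningTerm k F ((c ∷ []) ∷ [])              ≈⟨ coarseningTerm-own k F c [] ⟩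
      inv s * own []                                  ≈⟨ *-congˡ (+-identityʳ _) ⟨
      inv s * (own [] + 0#)                           ≈⟨ *-congˡ (+-identityʳ _) ⟨
      inv s * ((own [] + 0#) + 0#)                    ≈⟨ *-congˡ (+-congˡ empty≈0) ⟨
      inv s * ((own [] + 0#) + (inv 1 * F [] + 0#))   ∎
      where
      s = suc (k ℕ.+ c)
      own = coarseningTerm 0 (λ β → F (k ℕ.+ c ∷ β))
      empty≈0 : inv 1 * F [] + 0# ≈ 0#
      empty≈0 = ≈-trans (+-identityʳ _) (≈-trans (*-congˡ F[]≈0) (zeroʳ _))
    coarseningSum-∷ k F c (d ∷ γ) _ = begin
      ∑ term (blockings (c ∷ d ∷ γ))
        ≡⟨ cong (∑ term) (blockings-∷ c (d ∷ γ)) ⟩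
      ∑ term (concatMap (extendBlocking c) Bs)              ≈⟨ ∑-concatMap term _ Bs ⟩
      ∑ (λ B → ∑ term (extendBlocking c B)) Bs
        ≈⟨ ∑-congᴬ (All.map extension-terms (blockings-nonEmpty d γ)) ⟩
      ∑ (λ B → inv s * (own B + joined B)) Bs               ≈⟨ *-distribˡ-∑ (inv s) _ Bs ⟩
      inv s * ∑ (λ B → own B + joined B) Bs                 ≈⟨ *-congˡ (∑-+ own joined Bs) ⟩
      inv s * (∑ own Bs + ∑ joined Bs)                      ∎
      where
      s = suc (k ℕ.+ c)
      Bs = blockings (d ∷ γ)
      term own joined : List Comp → Carrier
      term   = coarseningTerm k F
      own    = coarseningTerm 0 (λ β → F (k ℕ.+ c ∷ β))
      joined = coarseningTerm s F
      extension-terms : ∀ {B} → NonEmpty B →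
                        ∑ term (extendBlocking c B) ≈ inv s * (own B + joined B)
      extension-terms (b ∷ B) = begin
        term ((c ∷ []) ∷ b ∷ B) + (term ((c ∷ b) ∷ B) + 0#)   ≈⟨ +-congˡ (+-identityʳ _) ⟩
        term ((c ∷ []) ∷ b ∷ B) + term ((c ∷ b) ∷ B)
          ≈⟨ +-cong (coarseningTerm-own k F c (b ∷ B)) (coarseningTerm-joined k F c b B) ⟩
        inv s * own (b ∷ B) + inv s * joined (b ∷ B)           ≈⟨ distribˡ (inv s) _ _ ⟨
        inv s * (own (b ∷ B) + joined (b ∷ B))                 ∎

    mutual
      coarseningSum-minOneΔM-shift : ∀ k a α γ →
        coarseningSum k (minOneΔM (a ∷ α)) γ ≈ δ (a ∷ α) (shiftHead k γ)
      coarseningSum-minOneΔM-shift k a α [] =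
        ≈-trans (+-identityʳ _) (≈-trans (*-congˡ (minOneΔM-[] a α)) (zeroʳ _))
      coarseningSum-minOneΔM-shift k a α (c ∷ γ) with ℕ.<-cmp a (k ℕ.+ c)
      ... | tri< a<k+c _ _ = begin
        coarseningSum k (minOneΔM (a ∷ α)) (c ∷ γ)
          ≈⟨ coarseningSum-∷ k (minOneΔM (a ∷ α)) c γ (minOneΔM-[] a α) ⟩
        inv s * (_ + coarseningSum s (minOneΔM (a ∷ α)) γ)
          ≈⟨ *-congˡ (+-cong (coarseningSum-vanish 0 (λ β → minOneΔM-near a (k ℕ.+ c) α β a<k+c) γ)
                             (≈-trans (coarseningSum-minOneΔM-shift s a α γ)
                                      (δ-shiftHead-< α γ (ℕ.m<n⇒m<1+n a<k+c)))) ⟩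
        inv s * (0# + 0#)
          ≈⟨ ≈-trans (*-congˡ (+-identityʳ 0#)) (zeroʳ _) ⟩
        0#
          ≈⟨ δ-∷-≢ α γ (ℕ.>⇒≢ a<k+c) ⟨
        δ (a ∷ α) (k ℕ.+ c ∷ γ) ∎
        where s = suc (k ℕ.+ c)
      ... | tri≈ _ refl _ = begin
        coarseningSum k (minOneΔM (a ∷ α)) (c ∷ γ)
          ≈⟨ coarseningSum-∷ k (minOneΔM (a ∷ α)) c γ (minOneΔM-[] a α) ⟩
        inv s * (_ + coarseningSum s (minOneΔM (a ∷ α)) γ)
          ≈⟨ *-congˡ (+-cong (coarseningSum-cong 0 (minOneΔM-head a α) γ)
                             (≈-trans (coarseningSum-minOneΔM-shift s a α γ)
                                      (δ-shiftHead-< α γ (ℕ.n<1+n a)))) ⟩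
        inv s * (coarseningSum 0 (λ β → natR s * minOneΔM α β) γ + 0#)
          ≈⟨ *-congˡ (≈-trans (+-identityʳ _) (coarseningSum-scale 0 (natR s) (minOneΔM α) γ)) ⟩
        inv s * (natR s * coarseningSum 0 (minOneΔM α) γ)
          ≈⟨ *-congˡ (*-congˡ (coarseningSum-minOneΔM α γ)) ⟩
        inv s * (natR s * δ α γ)
          ≈⟨ *-assoc _ _ _ ⟨
        (inv s * natR s) * δ α γ
          ≈⟨ *-congʳ (≈-trans (*-comm _ _) (natR*inv≈1 a)) ⟩
        1# * δ α γ
          ≈⟨ ≈-trans (*-identityˡ _) (≈-sym (δ-∷-same a α γ)) ⟩
        δ (a ∷ α) (a ∷ γ) ∎
        where s = suc a
      ... | tri> _ _ k+c<a with ℕ.m≤n⇒∃[o]m+o≡n k+c<a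
      ...   | q , refl = begin
        coarseningSum k (minOneΔM (s ℕ.+ q ∷ α)) (c ∷ γ)
          ≈⟨ coarseningSum-∷ k (minOneΔM (s ℕ.+ q ∷ α)) c γ (minOneΔM-[] (s ℕ.+ q) α) ⟩
        inv s * (_ + coarseningSum s (minOneΔM (s ℕ.+ q ∷ α)) γ)
          ≈⟨ *-congˡ (+-cong (≈-trans (coarseningSum-cong 0 (minOneΔM-far (k ℕ.+ c) q α) γ)
                                      (coarseningSum-neg 0 (minOneΔM (q ∷ α)) γ))
                             (coarseningSum-minOneΔM-shift s (s ℕ.+ q) α γ)) ⟩
        inv s * (- coarseningSum 0 (minOneΔM (q ∷ α)) γ + δ (s ℕ.+ q ∷ α) (shiftHead s γ))
          ≈⟨ *-congˡ (+-cong (-‿cong (coarseningSum-minOneΔM-shift 0 q α γ))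
                             (δ-shiftHead-+ s q α γ)) ⟩
        inv s * (- δ (q ∷ α) (shiftHead 0 γ) + δ (q ∷ α) (shiftHead 0 γ))
          ≈⟨ ≈-trans (*-congˡ (-‿inverseˡ _)) (zeroʳ _) ⟩
        0#
          ≈⟨ δ-∷-≢ α γ (ℕ.m≢1+m+n (k ℕ.+ c)) ⟨
        δ (s ℕ.+ q ∷ α) (k ℕ.+ c ∷ γ) ∎
        where s = suc (k ℕ.+ c)

      coarseningSum-minOneΔM : ∀ α γ → coarseningSum 0 (minOneΔM α) γ ≈ δ α γ
      coarseningSum-minOneΔM []      []      =
        ≈-trans (+-identityʳ _) (≈-trans (*-identityʳ _) inv-1)
      coarseningSum-minOneΔM []      (c ∷ γ) =
        ∑-vanishᴬ (All.map merged-nonEmpty (blockings-nonEmpty c γ))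
        where
        merged-nonEmpty : ∀ {B} → NonEmpty B → coarseningTerm 0 (minOneΔM []) B ≈ 0#
        merged-nonEmpty (b ∷ B) = zeroʳ _
      coarseningSum-minOneΔM (a ∷ α) γ = ≈-trans (coarseningSum-minOneΔM-shift 0 a α γ)
                                                 (reflexive (cong (δ (a ∷ α)) (shiftHead-0 γ)))

    lin-minOneΔM-psiM : ∀ α γ → lin (minOneΔM α) (psiM γ) ≈ δ α γ
    lin-minOneΔM-psiM α γ = ≈-trans (lin-psiM (minOneΔM α) γ) (coarseningSum-minOneΔM α γ)

theorem3p5 : ∀ {c ℓ} (R : CommutativeRing c ℓ) (inv : ℕ → CommutativeRing.Carrier R) →
    let open CommutativeRing R
        open QSym R inv
    in (∀ n → natR (suc n) * inv (suc n) ≈ 1#) →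
       (μ : Comp → Carrier) → IsMinOne μ →
       (f cs : Lin) →
       (∀ β → coeff f β ≈ coeff (psiToM cs) β) →
       ∀ α → coeff cs α ≈ minOneΔ μ α f
theorem3p5 R inv natR*inv≈1 μ isMinOne f cs f≈ψ α = begin
  coeff cs α
    ≈⟨ coeff≈lin-δ cs α ⟩
  lin (δ α) cs
    ≈⟨ ∑-cong (λ p → *-congˡ (lin-minOneΔM-psiM α (proj₂ p))) cs ⟨
  ∑ (λ p → proj₁ p * lin (minOneΔM α) (psiM (proj₂ p))) cs
    ≈⟨ lin-psiToM (minOneΔM α) cs ⟨
  lin (minOneΔM α) (psiToM cs)
    ≈⟨ lin-coeff-ext (minOneΔM α) f (psiToM cs) f≈ψ ⟨
  lin (minOneΔM α) f
    ≈⟨ lin-cong (minOneΔ-onM-minOneM μ (isMinOne-unique μ isMinOne) α) f ⟨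
  lin (minOneΔ-onM μ α) f
    ≡⟨⟩
  minOneΔ μ α f ∎
  where
  open CommutativeRing R
  open QSym R inv
  open Properties R inv
  open Inverses natR*inv≈1
  open import Relation.Binary.Reasoning.Setoid setoid
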